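{- Let $R$ be a unique factorization domain, and let $\mathfrak{a}=(a)$ for some $a\in R$ such that $R/\mathfrak{a}$ is a finite ring. Then $$I_r(R/\mathfrak{a})\geq \mathsf{D}((R/\mathfrak{a})^\times)+\Omega(a)-\omega(a).$$ Moreover, equality holds whenever $a$ is a prime power. If $R$ is a principal ideal domain, then equality also holds whenever $a$ is a product of distinct primes, i.e., $a$ is not divisible by the square of any prime.
   Context: For a finite commutative ring $T$, $I_r(T)$ is the smallest positive integer $t$ such that every sequence of $t$ (not necessarily distinct) elements of $T$ contains a nonempty subsequence whose elements multiply to an idempotent element of $T$ (an element $x$ with $x^2=x$). For a finite abelian group $G$, $\mathsf{D}(G)$ (Davenport constant) is the smallest positive integer $t$ such that every sequence of $t$ elements of $G$ contains a nonempty subsequence whose elements multiply to the identity; $(R/\mathfrak{a})^\times$ is the unit group of $R/\mathfrak{a}$. For an element $a$ of a UFD, $\Omega(a)$ is the total number of primes in the prime factorization of $a$ counted with multiplicity, and $\omega(a)$ is the number of distinct primes (up to multiplication by units) in this factorization. -}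

module Defs where

open import Level using (_⊔_)
import Level
open import Algebra.Bundles using (CommutativeRing)
open import Data.Nat as ℕ using (ℕ; zero; suc)
open import Data.Bool using (Bool; true; false)
open import Data.Fin using (Fin)
import Data.Fin as Fin
open import Data.Fin.Subset using (Subset; Nonempty)
open import Data.Vec using (_∷_; [])
open import Data.List using (List; foldr; length)
open import Data.List.Relation.Unary.All using (All)
open import Data.List.Relation.Unary.Any using (Any)
open import Data.List.Relation.Unary.AllPairs using (AllPairs)
open import Data.List.Relation.Binary.Permutation.Homogeneous using (Permutation)
open import Data.Product using (Σ; ∃; _×_; proj₁)
open import Data.Sum using (_⊎_)
open import Relation.Nullary using (¬_)
open import Relation.Binary.PropositionalEquality using (_≡_)
open import Function using (_∘_)

subProd : ∀ {a} {A : Set a} (_∙_ : A → A → A) (ε : A) {t : ℕ} → (Fin t → A) → Subset t → A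
subProd _∙_ ε {zero} s [] = ε
subProd _∙_ ε {suc t} s (true ∷ S) = s Fin.zero ∙ subProd _∙_ ε (s ∘ Fin.suc) S
subProd _∙_ ε {suc t} s (false ∷ S) = subProd _∙_ ε (s ∘ Fin.suc) S

IsLeastPos : ∀ {p} → (ℕ → Set p) → ℕ → Set p
IsLeastPos P t = (1 ℕ.≤ t) × P t × (∀ t′ → 1 ℕ.≤ t′ → t′ ℕ.< t → ¬ P t′)

module RingDefs {c ℓ} (R : CommutativeRing c ℓ) where
  open CommutativeRing R

  prod : List Carrier → Carrier
  prod = foldr _*_ 1#

  pow : Carrier → ℕ → Carrier
  pow x zero = 1#
  pow x (suc k) = x * pow x k

  _∣_ : Carrier → Carrier → Set (c ⊔ ℓ)
  x ∣ y = ∃ λ k → y ≈ x * k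

  IsUnit : Carrier → Set (c ⊔ ℓ)
  IsUnit u = ∃ λ v → u * v ≈ 1#

  Assoc : Carrier → Carrier → Set (c ⊔ ℓ)
  Assoc x y = ∃ λ u → IsUnit u × x ≈ u * y

  Irreducible : Carrier → Set (c ⊔ ℓ)
  Irreducible p = ¬ IsUnit p × ¬ (p ≈ 0#) × (∀ x y → p ≈ x * y → IsUnit x ⊎ IsUnit y)

  IsIntegralDomain : Set (c ⊔ ℓ)
  IsIntegralDomain = ¬ (1# ≈ 0#) × (∀ x y → x * y ≈ 0# → x ≈ 0# ⊎ y ≈ 0#)

  Factorization : Carrier → Carrier → List Carrier → Set (c ⊔ ℓ)
  Factorization a u ps = IsUnit u × All Irreducible ps × a ≈ u * prod ps

  IsUFD : Set (c ⊔ ℓ)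
  IsUFD = IsIntegralDomain
        × (∀ x → ¬ (x ≈ 0#) → ∃ λ u → ∃ λ ps → Factorization x u ps)
        × (∀ x u v ps qs → Factorization x u ps → Factorization x v qs → Permutation Assoc ps qs)

  IsIdeal : (Carrier → Set (c ⊔ ℓ)) → Set (c ⊔ ℓ)
  IsIdeal I = (∀ x y → x ≈ y → I x → I y) × I 0# × (∀ x y → I x → I y → I (x + y))
            × (∀ r x → I x → I (r * x))

  IsPID : Set (Level.suc (c ⊔ ℓ))
  IsPID = IsIntegralDomain × (∀ (I : Carrier → Set (c ⊔ ℓ)) → IsIdeal I →
            ∃ λ g → ∀ x → (I x → g ∣ x) × (g ∣ x → I x))

  DistinctPrimes : List Carrier → List Carrier → Set (c ⊔ ℓ)
  DistinctPrimes ps qs = AllPairs (λ p q → ¬ Assoc p q) qs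
                       × All (λ q → Any (Assoc q) ps) qs
                       × All (λ p → Any (Assoc p) qs) ps

  IsPrimePower : Carrier → Set (c ⊔ ℓ)
  IsPrimePower a = ∃ λ p → ∃ λ k → Irreducible p × 1 ℕ.≤ k × Assoc a (pow p k)

  SquareFree : Carrier → Set (c ⊔ ℓ)
  SquareFree a = ∀ p → Irreducible p → ¬ ((p * p) ∣ a)

  -- the quotient ring R/(a): same carrier, congruence x ~ y iff a ∣ x - y
  module Quot (a : Carrier) where
    _~_ : Carrier → Carrier → Set (c ⊔ ℓ)
    x ~ y = a ∣ (x - y)

    IsFinite : Set (c ⊔ ℓ)
    IsFinite = ∃ λ n → ∃ λ (f : Fin n → Carrier) →
                 (∀ x → ∃ λ i → f i ~ x) × (∀ i j → f i ~ f j → i ≡ j)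

    IsIdempotent : Carrier → Set (c ⊔ ℓ)
    IsIdempotent x = (x * x) ~ x

    IsUnitQ : Carrier → Set (c ⊔ ℓ)
    IsUnitQ x = ∃ λ y → (x * y) ~ 1#

    IsIr : ℕ → Set (c ⊔ ℓ)
    IsIr = IsLeastPos (λ t → ∀ (s : Fin t → Carrier) →
             ∃ λ S → Nonempty S × IsIdempotent (subProd _*_ 1# s S))

    IsDUnits : ℕ → Set (c ⊔ ℓ)
    IsDUnits = IsLeastPos (λ t → ∀ (s : Fin t → Σ Carrier IsUnitQ) →
             ∃ λ S → Nonempty S × (subProd _*_ 1# (proj₁ ∘ s) S ~ 1#))

-- Write a ≈ u·∏Rs·∏Ls, where Rs holds one prime of each associate class dividing a and Ls the
-- remaining Ω(a) − ω(a) prime factors. Lower bound: append Ls to units g₁, …, g_{d−1} without a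
-- subproduct ≡ 1. An idempotent subproduct U·P (U from the gᵢ, P from Ls) must have P = 1: a prime
-- l ∣ P also divides ∏Rs, and ∏Rs·P ∣ a ∣ UP(UP − 1) gives l ∣ U(UP − 1), impossible as l ∤ U and
-- l ∣ UP. But then U is an idempotent unit, so U ≡ 1. Upper bound for a ~ pᴷ: every residue is
-- divisible by p or a unit, so among d + K − 1 residues either K are divisible by p (their product
-- is 0) or d are units (some subproduct is 1). For squarefree a every residue x is a unit times the
-- idempotent power of x, so d residues suffice. Finiteness of R/(a) supplies the idempotent powers
-- and decides divisibility by the divisors of a.
module Submission where

open import Defs
open import Algebra.Bundles using (CommutativeMonoid; CommutativeRing)
open import Level using (_⊔_)
open import Data.Nat as ℕ using (ℕ; zero; suc; _∸_; z≤n; s≤s)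
import Data.Nat.Properties as ℕ
open import Data.Nat.Tactic.RingSolver using (solve-∀)
open import Data.Bool using (true; false)
open import Data.Fin using (Fin; zero; suc; toℕ)
import Data.Fin as Fin
import Data.Fin.Properties as Fin
open import Data.Fin.Subset using (Subset; _∈_; _⊆_; ∁; ⊥; Nonempty; Empty)
import Data.Fin.Subset as Subset
open import Data.Fin.Subset.Properties using (Empty-unique; ∣∁p∣≡n∸∣p∣; x∈∁p⇒x∉p)
open import Data.Vec using (_∷_; []; _++_; tabulate; here; there)
import Data.Vec as Vec
import Data.Vec.Properties as Vec
import Data.Vec.Functional as Seq
import Data.Vec.Functional.Properties as Seq
open import Data.List using (List; []; _∷_; [_]; length; lookup)
import Data.List as List
import Data.List.Properties as List
open import Data.List.Membership.Propositional using (find)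
open import Data.List.Membership.Propositional.Properties using (∈-∃++; ∈-lookup)
open import Data.List.Relation.Unary.Any using (Any; here; there)
import Data.List.Relation.Unary.Any as Any
import Data.List.Relation.Unary.Any.Properties as Any
open import Data.List.Relation.Unary.All using (All; []; _∷_)
import Data.List.Relation.Unary.All as All
import Data.List.Relation.Unary.All.Properties as All
open import Data.List.Relation.Unary.AllPairs using (AllPairs; []; _∷_)
open import Data.List.Relation.Binary.Pointwise using (Pointwise; []; _∷_; AllPairs-resp-Pointwise; Any-resp-Pointwise)
open import Data.List.Relation.Binary.Pointwise.Properties using (Pointwise-length)
open import Data.List.Relation.Binary.Permutation.Propositional using (_↭_; ↭-refl; ↭-trans; ↭-prep; ↭⇒↭ₛ′)
import Data.List.Relation.Binary.Permutation.Propositional.Properties as ↭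
import Data.List.Relation.Binary.Permutation.Setoid.Properties as PermutationProperties
open import Data.Product using (Σ; ∃; ∃₂; _×_; _,_; proj₁; proj₂)
import Data.Product as Product
open import Data.Sum using (_⊎_; inj₁; inj₂; [_,_]′)
import Data.Sum as Sum
open import Relation.Nullary using (¬_; Dec; yes; no; does; contradiction)
open import Relation.Nullary.Decidable using (dec-true)
open import Relation.Unary as U using (Pred)
open import Relation.Binary.Bundles using (Setoid)
open import Relation.Binary.Definitions using (Decidable)
import Relation.Binary.PropositionalEquality as ≡
open import Function using (_∘_; id)

IsLeastPos-≤ : ∀ {p} {P : ℕ → Set p} {t m} → IsLeastPos P t → ¬ P 0 → P m → t ℕ.≤ m
IsLeastPos-≤ {m = zero} _ ¬P0 P0 = contradiction P0 ¬P0
IsLeastPos-≤ {m = suc m} (_ , _ , minimal) _ Pm = ℕ.≮⇒≥ (λ m<t → minimal (suc m) (s≤s z≤n) m<t Pm)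

compress : ∀ {a} {A : Set a} {n} (C : Subset n) → (Fin n → A) → Fin Subset.∣ C ∣ → A
compress (true ∷ C) s zero = s zero
compress (true ∷ C) s (suc i) = compress C (s ∘ suc) i
compress (false ∷ C) s = compress C (s ∘ suc)

expand : ∀ {n} (C : Subset n) → Subset Subset.∣ C ∣ → Subset n
expand [] T = []
expand (true ∷ C) (b ∷ T) = b ∷ expand C T
expand (false ∷ C) T = false ∷ expand C T

expand-⊆ : ∀ {n} (C : Subset n) (T : Subset Subset.∣ C ∣) → expand C T ⊆ C
expand-⊆ (true ∷ C) (true ∷ T) here = here
expand-⊆ (true ∷ C) (b ∷ T) (there i∈) = there (expand-⊆ C T i∈)
expand-⊆ (false ∷ C) T (there i∈) = there (expand-⊆ C T i∈)

expand-Nonempty : ∀ {n} (C : Subset n) {T : Subset Subset.∣ C ∣} → Nonempty T → Nonempty (expand C T)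
expand-Nonempty (true ∷ C) (zero , here) = zero , here
expand-Nonempty (true ∷ C) (suc i , there i∈) = Product.map suc there (expand-Nonempty C (i , i∈))
expand-Nonempty (false ∷ C) T-nonempty = Product.map suc there (expand-Nonempty C T-nonempty)

Nonempty-++ˡ : ∀ {m n} {S : Subset m} (T : Subset n) → Nonempty S → Nonempty (S ++ T)
Nonempty-++ˡ T (zero , here) = zero , here
Nonempty-++ˡ {S = _ ∷ S} T (suc i , there i∈) = Product.map suc there (Nonempty-++ˡ T (i , i∈))

Nonempty-++⁻ : ∀ {m n} (S : Subset m) {T : Subset n} → Nonempty (S ++ T) → Nonempty S ⊎ Nonempty T
Nonempty-++⁻ [] T-nonempty = inj₂ T-nonempty
Nonempty-++⁻ (true ∷ S) _ = inj₁ (zero , here)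
Nonempty-++⁻ (false ∷ S) (suc i , there i∈) = Sum.map₁ (Product.map suc there) (Nonempty-++⁻ S (i , i∈))

Nonempty-split : ∀ m {n} (S : Subset (m ℕ.+ n)) → Nonempty S → Nonempty (Vec.take m S) ⊎ Nonempty (Vec.drop m S)
Nonempty-split m S = ≡.subst (λ S′ → Nonempty S′ → Nonempty (Vec.take m S) ⊎ Nonempty (Vec.drop m S))
                             (Vec.take++drop≡id m S) (Nonempty-++⁻ (Vec.take m S))

1≤∣S∣⇒Nonempty : ∀ {n} (S : Subset n) → 1 ℕ.≤ Subset.∣ S ∣ → Nonempty S
1≤∣S∣⇒Nonempty (true ∷ S) _ = zero , here
1≤∣S∣⇒Nonempty (false ∷ S) 1≤∣S∣ = Product.map suc there (1≤∣S∣⇒Nonempty S 1≤∣S∣)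

∁-size-≥ : ∀ d {l} (S : Subset (d ℕ.+ l)) → Subset.∣ S ∣ ℕ.≤ l → d ℕ.≤ Subset.∣ ∁ S ∣
∁-size-≥ d {l} S ∣S∣≤l = ℕ.≤-trans (ℕ.≤-reflexive (≡.sym (ℕ.m+n∸n≡m d l)))
                           (ℕ.≤-trans (ℕ.∸-monoʳ-≤ (d ℕ.+ l) ∣S∣≤l)
                                      (ℕ.≤-reflexive (≡.sym (∣∁p∣≡n∸∣p∣ S))))

module _ {n p} {P : Pred (Fin n) p} (P? : U.Decidable P) where

  select : Subset n
  select = tabulate (does ∘ P?)

  ∈-select⁻ : ∀ {i} → i ∈ select → P i
  ∈-select⁻ {i} i∈ with P? i | ≡.trans (≡.sym (Vec.lookup∘tabulate (does ∘ P?) i)) (Vec.[]=⇒lookup i∈)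
  ... | yes Pi | _ = Pi
  ... | no _ | ()

  ∈-select⁺ : ∀ {i} → P i → i ∈ select
  ∈-select⁺ {i} Pi = Vec.lookup⇒[]= i select (≡.trans (Vec.lookup∘tabulate (does ∘ P?) i) (dec-true (P? i) Pi))

  ∈-∁-select⁻ : ∀ {i} → i ∈ ∁ select → ¬ P i
  ∈-∁-select⁻ i∈ Pi = x∈∁p⇒x∉p i∈ (∈-select⁺ Pi)

module SubProduct {c ℓ} (M : CommutativeMonoid c ℓ) where
  open CommutativeMonoid M
  open import Algebra.Properties.CommutativeSemigroup commutativeSemigroup using (interchange)
  open import Relation.Binary.Reasoning.Setoid setoid

  ∏ : ∀ {n} → (Fin n → Carrier) → Subset n → Carrier
  ∏ = subProd _∙_ ε

  ∏-cong : ∀ {n} {s s′ : Fin n → Carrier} (S : Subset n) → (∀ i → i ∈ S → s i ≈ s′ i) →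
           ∏ s S ≈ ∏ s′ S
  ∏-cong [] _ = refl
  ∏-cong (true ∷ S) eq = ∙-cong (eq zero here) (∏-cong S (λ i → eq (suc i) ∘ there))
  ∏-cong (false ∷ S) eq = ∏-cong S (λ i → eq (suc i) ∘ there)

  ∏-⊥ : ∀ {n} (s : Fin n → Carrier) → ∏ s ⊥ ≈ ε
  ∏-⊥ {zero} s = refl
  ∏-⊥ {suc n} s = ∏-⊥ (s ∘ suc)

  ∏-Empty : ∀ {n} (s : Fin n → Carrier) {S : Subset n} → Empty S → ∏ s S ≈ ε
  ∏-Empty s empty rewrite Empty-unique empty = ∏-⊥ s

  ∏-++ : ∀ {m n} (s : Fin (m ℕ.+ n) → Carrier) (S : Subset m) (T : Subset n) →
         ∏ s (S ++ T) ≈ ∏ (Seq.take m s) S ∙ ∏ (Seq.drop m s) T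
  ∏-++ s [] T = sym (identityˡ _)
  ∏-++ s (true ∷ S) T = trans (∙-congˡ (∏-++ (s ∘ suc) S T)) (sym (assoc _ _ _))
  ∏-++ s (false ∷ S) T = ∏-++ (s ∘ suc) S T

  ∏-++-++ : ∀ {m n} (s : Fin m → Carrier) (t : Fin n → Carrier) (S : Subset m) (T : Subset n) →
            ∏ (s Seq.++ t) (S ++ T) ≈ ∏ s S ∙ ∏ t T
  ∏-++-++ s t S T = trans (∏-++ (s Seq.++ t) S T)
    (∙-cong (∏-cong S (λ i _ → reflexive (Seq.lookup-++ˡ s t i)))
            (∏-cong T (λ i _ → reflexive (Seq.lookup-++ʳ s t i))))

  ∏-split : ∀ {m n} (s : Fin m → Carrier) (t : Fin n → Carrier) (S : Subset (m ℕ.+ n)) →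
            ∏ (s Seq.++ t) S ≈ ∏ s (Vec.take m S) ∙ ∏ t (Vec.drop m S)
  ∏-split {m} s t S = ≡.subst (λ S′ → ∏ (s Seq.++ t) S′ ≈ ∏ s (Vec.take m S) ∙ ∏ t (Vec.drop m S))
                               (Vec.take++drop≡id m S) (∏-++-++ s t (Vec.take m S) (Vec.drop m S))

  ∏-∙ : ∀ {n} (s s′ : Fin n → Carrier) (S : Subset n) → ∏ (λ i → s i ∙ s′ i) S ≈ ∏ s S ∙ ∏ s′ S
  ∏-∙ s s′ [] = sym (identityˡ ε)
  ∏-∙ s s′ (true ∷ S) = begin
    (s zero ∙ s′ zero) ∙ ∏ _ S             ≈⟨ ∙-congˡ (∏-∙ (s ∘ suc) (s′ ∘ suc) S) ⟩
    (s zero ∙ s′ zero) ∙ (∏ _ S ∙ ∏ _ S)   ≈⟨ interchange _ _ _ _ ⟩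
    (s zero ∙ ∏ _ S) ∙ (s′ zero ∙ ∏ _ S)   ∎
  ∏-∙ s s′ (false ∷ S) = ∏-∙ (s ∘ suc) (s′ ∘ suc) S

  ∏-closed : ∀ {p} (P : Carrier → Set p) → P ε → (∀ {x y} → P x → P y → P (x ∙ y)) →
             ∀ {n} (s : Fin n → Carrier) → (∀ i → P (s i)) → ∀ S → P (∏ s S)
  ∏-closed P Pε P∙ s Ps [] = Pε
  ∏-closed P Pε P∙ s Ps (true ∷ S) = P∙ (Ps zero) (∏-closed P Pε P∙ (s ∘ suc) (Ps ∘ suc) S)
  ∏-closed P Pε P∙ s Ps (false ∷ S) = ∏-closed P Pε P∙ (s ∘ suc) (Ps ∘ suc) S

  ∏-compress : ∀ {x} {X : Set x} (h : X → Carrier) {n} (C : Subset n) (s : Fin n → X) (T : Subset Subset.∣ C ∣) →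
               ∏ (h ∘ compress C s) T ≈ ∏ (h ∘ s) (expand C T)
  ∏-compress h [] s [] = refl
  ∏-compress h (true ∷ C) s (true ∷ T) = ∙-congˡ (∏-compress h C (s ∘ suc) T)
  ∏-compress h (true ∷ C) s (false ∷ T) = ∏-compress h C (s ∘ suc) T
  ∏-compress h (false ∷ C) s T = ∏-compress h C (s ∘ suc) T

  module _ {x q} {X : Set x} (h : X → Carrier) (P : Carrier → Set q) where

    SubproductProperty : ℕ → Set (x ⊔ q)
    SubproductProperty t = ∀ (s : Fin t → X) → ∃ λ S → Nonempty S × P (∏ (h ∘ s) S)

    ¬SubproductProperty-0 : ¬ SubproductProperty 0
    ¬SubproductProperty-0 P0 with P0 (λ ())
    ... | [] , (() , _) , _

    SubproductProperty-mono : (∀ {y z} → y ≈ z → P y → P z) → ∀ {m n} → m ℕ.≤ n →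
                              SubproductProperty m → SubproductProperty n
    SubproductProperty-mono P-resp {m} m≤n Pm with ℕ.m≤n⇒∃[o]m+o≡n m≤n
    ... | e , ≡.refl = λ s → extend s (Pm (Seq.take m s))
      where
      extend : (s : Fin (m ℕ.+ e) → X) → (∃ λ S → Nonempty S × P (∏ (h ∘ Seq.take m s) S)) →
               ∃ λ S → Nonempty S × P (∏ (h ∘ s) S)
      extend s (S , S-nonempty , PS) = S ++ ⊥ , Nonempty-++ˡ ⊥ S-nonempty , P-resp padded PS
        where
        padded : ∏ (h ∘ Seq.take m s) S ≈ ∏ (h ∘ s) (S ++ ⊥)
        padded = sym (trans (∏-++ (h ∘ s) S ⊥) (trans (∙-congˡ (∏-⊥ (Seq.drop m (h ∘ s)))) (identityʳ _)))

module _ {c ℓ} (S : Setoid c ℓ) where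
  open Setoid S

  enumerated⇒decidable : ∀ {n} (f : Fin n → Carrier) → (∀ x → ∃ λ i → f i ≈ x) →
                         (∀ i j → f i ≈ f j → i ≡.≡ j) → Decidable _≈_
  enumerated⇒decidable f onto inj x y with proj₁ (onto x) Fin.≟ proj₁ (onto y)
  ... | yes i≡j = yes (trans (sym (proj₂ (onto x))) (trans (reflexive (≡.cong f i≡j)) (proj₂ (onto y))))
  ... | no i≢j = no (λ x≈y → i≢j (inj _ _ (trans (proj₂ (onto x)) (trans x≈y (sym (proj₂ (onto y)))))))

module Divisibility {c ℓ} (R : CommutativeRing c ℓ) where
  open CommutativeRing R hiding (zero)
  open RingDefs R renaming (_∣_ to infix 4 _∣_)
  open import Algebra.Properties.Ring ring using (-‿distribʳ-*; -‿involutive)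
  open import Algebra.Properties.AbelianGroup +-abelianGroup using (⁻¹-∙-comm)
  open import Algebra.Solver.Ring.NaturalCoefficients.Default commutativeSemiring
  open import Relation.Binary.Reasoning.Setoid setoid
  open SubProduct *-commutativeMonoid

  ∣-refl : ∀ x → x ∣ x
  ∣-refl x = 1# , sym (*-identityʳ x)

  ≈⇒∣ : ∀ {x y} → x ≈ y → x ∣ y
  ≈⇒∣ {x} x≈y = 1# , trans (sym x≈y) (sym (*-identityʳ x))

  ∣-trans : ∀ {x y z} → x ∣ y → y ∣ z → x ∣ z
  ∣-trans {x} (k , y≈xk) (l , z≈yl) = k * l , trans z≈yl (trans (*-congʳ y≈xk) (*-assoc x k l))

  ∣-respʳ : ∀ {x y y′} → y ≈ y′ → x ∣ y → x ∣ y′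
  ∣-respʳ y≈y′ (k , y≈xk) = k , trans (sym y≈y′) y≈xk

  ∣-respˡ : ∀ {x x′ y} → x ≈ x′ → x ∣ y → x′ ∣ y
  ∣-respˡ x≈x′ (k , y≈xk) = k , trans y≈xk (*-congʳ x≈x′)

  x∣y⇒x∣yz : ∀ {x y} z → x ∣ y → x ∣ y * z
  x∣y⇒x∣yz {x} z (k , y≈xk) = k * z , trans (*-congʳ y≈xk) (*-assoc x k z)

  x∣y⇒x∣zy : ∀ {x y} z → x ∣ y → x ∣ z * y
  x∣y⇒x∣zy z x∣y = ∣-respʳ (*-comm _ z) (x∣y⇒x∣yz z x∣y)

  x∣0 : ∀ x → x ∣ 0#
  x∣0 x = 0# , sym (zeroʳ x)

  ∣-+ : ∀ {x y z} → x ∣ y → x ∣ z → x ∣ y + z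
  ∣-+ {x} (k , y≈xk) (l , z≈xl) = k + l , trans (+-cong y≈xk z≈xl) (sym (distribˡ x k l))

  ∣-neg : ∀ {x y} → x ∣ y → x ∣ - y
  ∣-neg {x} (k , y≈xk) = - k , trans (-‿cong y≈xk) (-‿distribʳ-* x k)

  ∣-− : ∀ {x y z} → x ∣ y → x ∣ z → x ∣ y - z
  ∣-− x∣y x∣z = ∣-+ x∣y (∣-neg x∣z)

  ∣-−⁻ : ∀ {x y z} → x ∣ y → x ∣ y - z → x ∣ z
  ∣-−⁻ {y = y} {z} x∣y x∣y-z = ∣-respʳ y-[y-z]≈z (∣-− x∣y x∣y-z)
    where
    y-[y-z]≈z : y - (y - z) ≈ z
    y-[y-z]≈z = begin
      y - (y - z)         ≈⟨ +-congˡ (⁻¹-∙-comm y (- z)) ⟨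
      y + (- y + - - z)   ≈⟨ +-assoc y (- y) _ ⟨
      (y - y) + - - z     ≈⟨ +-cong (-‿inverseʳ y) (-‿involutive z) ⟩
      0# + z              ≈⟨ +-identityˡ z ⟩
      z                   ∎

  *-∣-* : ∀ {x x′ y y′} → x ∣ y → x′ ∣ y′ → x * x′ ∣ y * y′
  *-∣-* {x} {x′} (k , y≈xk) (l , y′≈x′l) = k * l , trans (*-cong y≈xk y′≈x′l)
    (solve 4 (λ x k x′ l → (x :* k) :* (x′ :* l) := (x :* x′) :* (k :* l)) refl x k x′ l)

  IsUnit-1 : IsUnit 1#
  IsUnit-1 = 1# , *-identityˡ 1#

  IsUnit-* : ∀ {u v} → IsUnit u → IsUnit v → IsUnit (u * v)
  IsUnit-* {u} {v} (u′ , uu′≈1) (v′ , vv′≈1) = u′ * v′ , (begin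
    (u * v) * (u′ * v′) ≈⟨ solve 4 (λ u v u′ v′ → (u :* v) :* (u′ :* v′) := (u :* u′) :* (v :* v′))
                                   refl u v u′ v′ ⟩
    (u * u′) * (v * v′) ≈⟨ *-cong uu′≈1 vv′≈1 ⟩
    1# * 1#             ≈⟨ *-identityˡ 1# ⟩
    1#                  ∎)

  ∣1⇒IsUnit : ∀ {x} → x ∣ 1# → IsUnit x
  ∣1⇒IsUnit (k , 1≈xk) = k , sym 1≈xk

  ∣IsUnit⇒IsUnit : ∀ {x u} → x ∣ u → IsUnit u → IsUnit x
  ∣IsUnit⇒IsUnit x∣u (v , uv≈1) = ∣1⇒IsUnit (∣-respʳ uv≈1 (x∣y⇒x∣yz v x∣u))

  Assoc-refl : ∀ x → Assoc x x
  Assoc-refl x = 1# , IsUnit-1 , sym (*-identityˡ x)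

  Assoc-sym : ∀ {x y} → Assoc x y → Assoc y x
  Assoc-sym {x} {y} (u , (v , uv≈1) , x≈uy) = v , (u , trans (*-comm v u) uv≈1) , (begin
    y             ≈⟨ sym (*-identityˡ y) ⟩
    1# * y        ≈⟨ *-congʳ (sym uv≈1) ⟩
    (u * v) * y   ≈⟨ solve 3 (λ u v y → (u :* v) :* y := v :* (u :* y)) refl u v y ⟩
    v * (u * y)   ≈⟨ *-congˡ (sym x≈uy) ⟩
    v * x         ∎)

  Assoc-trans : ∀ {x y z} → Assoc x y → Assoc y z → Assoc x z
  Assoc-trans {z = z} (u , u-unit , x≈uy) (v , v-unit , y≈vz) =
    u * v , IsUnit-* u-unit v-unit , trans x≈uy (trans (*-congˡ y≈vz) (sym (*-assoc u v z)))

  Assoc-* : ∀ {x x′ y y′} → Assoc x x′ → Assoc y y′ → Assoc (x * y) (x′ * y′)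
  Assoc-* {x′ = x′} {y′ = y′} (u , u-unit , x≈ux′) (v , v-unit , y≈vy′) =
    u * v , IsUnit-* u-unit v-unit , trans (*-cong x≈ux′ y≈vy′)
      (solve 4 (λ u x v y → (u :* x) :* (v :* y) := (u :* v) :* (x :* y)) refl u x′ v y′)

  Assoc⇒∣ : ∀ {x y} → Assoc x y → x ∣ y
  Assoc⇒∣ x~y = let u , _ , y≈ux = Assoc-sym x~y in u , trans y≈ux (*-comm u _)

  prod-++ : ∀ xs ys → prod (xs List.++ ys) ≈ prod xs * prod ys
  prod-++ [] ys = sym (*-identityˡ _)
  prod-++ (x ∷ xs) ys = trans (*-congˡ (prod-++ xs ys)) (sym (*-assoc x _ _))

  ∣-prod : ∀ {d} {xs} → Any (d ∣_) xs → d ∣ prod xs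
  ∣-prod {xs = x ∷ xs} (here d∣x) = x∣y⇒x∣yz (prod xs) d∣x
  ∣-prod {xs = x ∷ xs} (there d∣xs) = x∣y⇒x∣zy x (∣-prod d∣xs)

  pow-+ : ∀ x m n → pow x (m ℕ.+ n) ≈ pow x m * pow x n
  pow-+ x zero n = sym (*-identityˡ _)
  pow-+ x (suc m) n = trans (*-congˡ (pow-+ x m n)) (sym (*-assoc x _ _))

  pow-mono-∣ : ∀ x {m n} → m ℕ.≤ n → pow x m ∣ pow x n
  pow-mono-∣ x {n = n} z≤n = pow x n , sym (*-identityˡ _)
  pow-mono-∣ x (s≤s m≤n) = *-∣-* (∣-refl x) (pow-mono-∣ x m≤n)

  ∈⇒∣∏ : ∀ {n} (s : Fin n → Carrier) {S : Subset n} {i} → i ∈ S → s i ∣ ∏ s S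
  ∈⇒∣∏ s {true ∷ S} here = x∣y⇒x∣yz _ (∣-refl _)
  ∈⇒∣∏ s {true ∷ S} (there i∈S) = x∣y⇒x∣zy (s zero) (∈⇒∣∏ (s ∘ suc) i∈S)
  ∈⇒∣∏ s {false ∷ S} (there i∈S) = ∈⇒∣∏ (s ∘ suc) i∈S

  pow-∣-∏ : ∀ {n} p (s : Fin n → Carrier) (S : Subset n) → (∀ i → i ∈ S → p ∣ s i) →
            pow p Subset.∣ S ∣ ∣ ∏ s S
  pow-∣-∏ p s [] _ = ∣-refl 1#
  pow-∣-∏ p s (true ∷ S) p∣s = *-∣-* (p∣s zero here) (pow-∣-∏ p (s ∘ suc) S (λ i → p∣s (suc i) ∘ there))
  pow-∣-∏ p s (false ∷ S) p∣s = pow-∣-∏ p (s ∘ suc) S (λ i → p∣s (suc i) ∘ there)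

  ∏-∣-prod : ∀ xs (S : Subset (length xs)) → ∏ (lookup xs) S ∣ prod xs
  ∏-∣-prod [] [] = ∣-refl 1#
  ∏-∣-prod (x ∷ xs) (true ∷ S) = *-∣-* (∣-refl x) (∏-∣-prod xs S)
  ∏-∣-prod (x ∷ xs) (false ∷ S) = x∣y⇒x∣zy x (∏-∣-prod xs S)

  Irreducible⇒∤1 : ∀ {p} → Irreducible p → ¬ p ∣ 1#
  Irreducible⇒∤1 (p-nonunit , _) = p-nonunit ∘ ∣1⇒IsUnit

  Irreducible-∣⇒Assoc : ∀ {p q} → Irreducible p → Irreducible q → p ∣ q → Assoc q p
  Irreducible-∣⇒Assoc {p} p-irr (_ , _ , q-split) (k , q≈pk) with q-split p k q≈pk
  ... | inj₁ p-unit = contradiction p-unit (proj₁ p-irr)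
  ... | inj₂ k-unit = k , k-unit , trans q≈pk (*-comm p k)

  Assoc-setoid : Setoid c (c ⊔ ℓ)
  Assoc-setoid = record
    { Carrier = Carrier
    ; _≈_ = Assoc
    ; isEquivalence = record { refl = Assoc-refl _ ; sym = Assoc-sym ; trans = Assoc-trans }
    }

  Prime : Carrier → Set (c ⊔ ℓ)
  Prime p = Irreducible p × (∀ x y → p ∣ x * y → p ∣ x ⊎ p ∣ y)

  Prime-∣-pow : ∀ {p x} → Prime p → ∀ n → p ∣ pow x n → p ∣ x
  Prime-∣-pow (p-irr , _) zero p∣1 = contradiction p∣1 (Irreducible⇒∤1 p-irr)
  Prime-∣-pow {x = x} p-prime@(_ , euclid) (suc n) p∣xxⁿ with euclid x (pow x n) p∣xxⁿ
  ... | inj₁ p∣x = p∣x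
  ... | inj₂ p∣xⁿ = Prime-∣-pow p-prime n p∣xⁿ

  Prime-∣-prod : ∀ {p} → Prime p → ∀ xs → p ∣ prod xs → Any (p ∣_) xs
  Prime-∣-prod (p-irr , _) [] p∣1 = contradiction p∣1 (Irreducible⇒∤1 p-irr)
  Prime-∣-prod p-prime@(_ , euclid) (x ∷ xs) p∣x∏xs with euclid x (prod xs) p∣x∏xs
  ... | inj₁ p∣x = here p∣x
  ... | inj₂ p∣∏xs = there (Prime-∣-prod p-prime xs p∣∏xs)

  Prime-∣-unit*prod : ∀ {p u} → Prime p → IsUnit u → ∀ xs → p ∣ u * prod xs → Any (p ∣_) xs
  Prime-∣-unit*prod (p-irr , euclid) u-unit xs p∣u∏xs =
    [ (λ p∣u → contradiction (∣IsUnit⇒IsUnit p∣u u-unit) (proj₁ p-irr)) , Prime-∣-prod (p-irr , euclid) xs ]′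
      (euclid _ (prod xs) p∣u∏xs)

  Any-Assoc-trans : ∀ {p q xs} → Any (Assoc q) xs → All (λ x → Assoc x p) xs → Assoc q p
  Any-Assoc-trans (here q~x) (x~p ∷ _) = Assoc-trans q~x x~p
  Any-Assoc-trans (there q~xs) (_ ∷ xs~p) = Any-Assoc-trans q~xs xs~p

  prod-Assoc-pow : ∀ {p} xs → All (λ x → Assoc x p) xs → Assoc (prod xs) (pow p (length xs))
  prod-Assoc-pow [] [] = Assoc-refl 1#
  prod-Assoc-pow (x ∷ xs) (x~p ∷ xs~p) = Assoc-* x~p (prod-Assoc-pow xs xs~p)

module Representatives {c ℓ} (R : CommutativeRing c ℓ) where
  open CommutativeRing R
  open RingDefs R
  open Divisibility R

  private
    NonAssoc : Carrier → Carrier → Set (c ⊔ ℓ)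
    NonAssoc p q = ¬ Assoc p q

    skip-associate : ∀ {q r} ys zs → Assoc q r → ∀ {q′} → NonAssoc q q′ →
                     Any (Assoc q′) (ys List.++ [ r ] List.++ zs) → Any (Assoc q′) (ys List.++ zs)
    skip-associate {q} ys zs q~r q≁q′ q′~ with ↭.Any-resp-↭ (↭.shift _ ys zs) q′~
    ... | here q′~r = contradiction (Assoc-trans q~r (Assoc-sym q′~r)) q≁q′
    ... | there q′~ys++zs = q′~ys++zs

  pick-representatives : ∀ {ps} qs → AllPairs NonAssoc qs → All (λ q → Any (Assoc q) ps) qs →
                         ∃₂ λ Rs Ls → ps ↭ Rs List.++ Ls × Pointwise Assoc qs Rs
  pick-representatives {ps} [] [] [] = [] , ps , ↭-refl , []
  pick-representatives (q ∷ qs) (q≁qs ∷ qs-distinct) (q~ps ∷ qs~ps)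
    with r , r∈ps , q~r ← find q~ps
    with ys , zs , ≡.refl ← ∈-∃++ r∈ps
    with Rs , Ls , ys++zs↭ , qs~Rs ← pick-representatives qs qs-distinct
           (All.zipWith (λ (q≁q′ , q′~) → skip-associate ys zs q~r q≁q′ q′~) (q≁qs , qs~ps))
    = r ∷ Rs , Ls , ↭-trans (↭.shift r ys zs) (↭-prep r ys++zs↭) , q~r ∷ qs~Rs

module IntegralDomain {c ℓ} (R : CommutativeRing c ℓ) (domain : RingDefs.IsIntegralDomain R) where
  open CommutativeRing R hiding (zero)
  open RingDefs R renaming (_∣_ to infix 4 _∣_)
  open Divisibility R
  open import Algebra.Properties.Ring ring using (x[y-z]≈xy-xz; x≈y⇒x∙y⁻¹≈ε; x∙y⁻¹≈ε⇒x≈y)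
  open import Algebra.Solver.Ring.NaturalCoefficients.Default commutativeSemiring

  *-≉0 : ∀ {x y} → ¬ x ≈ 0# → ¬ y ≈ 0# → ¬ x * y ≈ 0#
  *-≉0 x≉0 y≉0 xy≈0 with proj₂ domain _ _ xy≈0
  ... | inj₁ x≈0 = x≉0 x≈0
  ... | inj₂ y≈0 = y≉0 y≈0

  *-cancelˡ : ∀ {k x y} → ¬ k ≈ 0# → k * x ≈ k * y → x ≈ y
  *-cancelˡ {k} {x} {y} k≉0 kx≈ky
    with proj₂ domain k (x - y) (trans (x[y-z]≈xy-xz k x y) (x≈y⇒x∙y⁻¹≈ε kx≈ky))
  ... | inj₁ k≈0 = contradiction k≈0 k≉0
  ... | inj₂ x-y≈0 = x∙y⁻¹≈ε⇒x≈y x y x-y≈0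

  *-cancelˡ-∣ : ∀ {k x y} → ¬ k ≈ 0# → k * x ∣ k * y → x ∣ y
  *-cancelˡ-∣ {k} {x} k≉0 (m , ky≈kxm) = m , *-cancelˡ k≉0 (trans ky≈kxm (*-assoc k x m))

  Prime-pow-∣-cancel : ∀ {p u} → Prime p → ¬ p ∣ u → ∀ k v → pow p k ∣ u * v → pow p k ∣ v
  Prime-pow-∣-cancel _ _ zero v _ = v , sym (*-identityˡ v)
  Prime-pow-∣-cancel {p} {u} p-prime@(p-irr , euclid) p∤u (suc k) v pᵏ⁺¹∣uv
    with euclid u v (∣-trans (x∣y⇒x∣yz (pow p k) (∣-refl p)) pᵏ⁺¹∣uv)
  ... | inj₁ p∣u = contradiction p∣u p∤u
  ... | inj₂ (v′ , v≈pv′) = ∣-respʳ (sym v≈pv′) (*-∣-* (∣-refl p) pᵏ∣v′)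
    where
    ppᵏ∣puv′ : p * pow p k ∣ p * (u * v′)
    ppᵏ∣puv′ = ∣-respʳ (trans (*-congˡ v≈pv′) (solve 3 (λ u p v′ → u :* (p :* v′) := p :* (u :* v′)) refl u p v′))
                       pᵏ⁺¹∣uv
    pᵏ∣v′ : pow p k ∣ v′
    pᵏ∣v′ = Prime-pow-∣-cancel p-prime p∤u k v′ (*-cancelˡ-∣ (proj₁ (proj₂ p-irr)) ppᵏ∣puv′)

  prod-Prime-∣ : ∀ {xs z} → All Prime xs → AllPairs (λ p q → ¬ Assoc p q) xs → All (_∣ z) xs → prod xs ∣ z
  prod-Prime-∣ {[]} {z} [] [] [] = z , sym (*-identityˡ z)
  prod-Prime-∣ {x ∷ xs} {z} (x-prime ∷ xs-prime) (x≁xs ∷ xs-distinct) ((z′ , z≈xz′) ∷ xs∣z) =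
    ∣-respʳ (sym z≈xz′) (*-∣-* (∣-refl x) (prod-Prime-∣ xs-prime xs-distinct (∣z′ xs-prime x≁xs xs∣z)))
    where
    ∣z′ : ∀ {ys} → All Prime ys → All (λ y → ¬ Assoc x y) ys → All (_∣ z) ys → All (_∣ z′) ys
    ∣z′ [] [] [] = []
    ∣z′ ((y-irr , euclid) ∷ ys-prime) (x≁y ∷ x≁ys) (y∣z ∷ ys∣z) with euclid x z′ (∣-respʳ z≈xz′ y∣z)
    ... | inj₁ y∣x = contradiction (Irreducible-∣⇒Assoc y-irr (proj₁ x-prime) y∣x) x≁y
    ... | inj₂ y∣z′ = y∣z′ ∷ ∣z′ ys-prime x≁ys ys∣z

module UniqueFactorisation {c ℓ} (R : CommutativeRing c ℓ) (ufd : RingDefs.IsUFD R) where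
  open CommutativeRing R hiding (zero)
  open RingDefs R renaming (_∣_ to infix 4 _∣_)
  open Divisibility R
  open IntegralDomain R (proj₁ ufd)
  open PermutationProperties Assoc-setoid using (Any-resp-↭)
  open import Algebra.Solver.Ring.NaturalCoefficients.Default commutativeSemiring
  open import Relation.Binary.Reasoning.Setoid setoid

  Factorization-* : ∀ {x y u v xs ys} → Factorization x u xs → Factorization y v ys →
                    Factorization (x * y) (u * v) (xs List.++ ys)
  Factorization-* {x} {y} {u} {v} {xs} {ys} (u-unit , xs-irr , x≈u∏xs) (v-unit , ys-irr , y≈v∏ys) =
    IsUnit-* u-unit v-unit , All.++⁺ xs-irr ys-irr , (begin
      x * y                             ≈⟨ *-cong x≈u∏xs y≈v∏ys ⟩
      (u * prod xs) * (v * prod ys)     ≈⟨ solve 4 (λ u a v b → (u :* a) :* (v :* b) := (u :* v) :* (a :* b))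
                                                 refl u (prod xs) v (prod ys) ⟩
      (u * v) * (prod xs * prod ys)     ≈⟨ *-congˡ (sym (prod-++ xs ys)) ⟩
      (u * v) * prod (xs List.++ ys)    ∎)

  Factorization-∷ : ∀ {p k u ks} → Irreducible p → Factorization k u ks → Factorization (p * k) u (p ∷ ks)
  Factorization-∷ {p} {k} {u} {ks} p-irr (u-unit , ks-irr , k≈u∏ks) = u-unit , p-irr ∷ ks-irr ,
    trans (*-congˡ k≈u∏ks) (solve 3 (λ p u a → p :* (u :* a) := u :* (p :* a)) refl p u (prod ks))

  Factorization⇒∣ : ∀ {x u xs} → Factorization x u xs → ∀ {p} → Any (Assoc p) xs → p ∣ x
  Factorization⇒∣ {u = u} (_ , _ , x≈u∏xs) p~xs =
    ∣-trans (∣-prod (Any.map Assoc⇒∣ p~xs)) (u , trans x≈u∏xs (*-comm u _))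

  Irreducible-∣-* : ∀ {p x y} → Irreducible p → ¬ x ≈ 0# → ¬ y ≈ 0# → p ∣ x * y → p ∣ x ⊎ p ∣ y
  Irreducible-∣-* {p} {x} {y} p-irr x≉0 y≉0 (k , xy≈pk)
    with proj₁ (proj₂ ufd) x x≉0 | proj₁ (proj₂ ufd) y y≉0 | proj₁ (proj₂ ufd) k k≉0
    where
    k≉0 : ¬ k ≈ 0#
    k≉0 k≈0 = *-≉0 x≉0 y≉0 (trans xy≈pk (trans (*-congˡ k≈0) (zeroʳ p)))
  ... | u , xs , x-fact | v , ys , y-fact | w , ks , k-fact
    with Any.++⁻ xs (Any-resp-↭ {P = Assoc p} (λ q~r p~q → Assoc-trans p~q q~r)
           (proj₂ (proj₂ ufd) (x * y) w (u * v) (p ∷ ks) (xs List.++ ys)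
             (Factorization-resp (sym xy≈pk) (Factorization-∷ p-irr k-fact)) (Factorization-* x-fact y-fact))
           (here (Assoc-refl p)))
    where
    Factorization-resp : ∀ {z z′ w ws} → z ≈ z′ → Factorization z w ws → Factorization z′ w ws
    Factorization-resp z≈z′ (w-unit , ws-irr , z≈w∏ws) = w-unit , ws-irr , trans (sym z≈z′) z≈w∏ws
  ... | inj₁ p~xs = inj₁ (Factorization⇒∣ x-fact p~xs)
  ... | inj₂ p~ys = inj₂ (Factorization⇒∣ y-fact p~ys)

module Idempotents {c ℓ} (R : CommutativeRing c ℓ) where
  open CommutativeRing R hiding (zero)
  open RingDefs R renaming (_∣_ to infix 4 _∣_)
  open import Algebra.Definitions _≈_ using (_IdempotentOn_)
  open import Algebra.Properties.Ring ring using (x[y-z]≈xy-xz; -0#≈0#)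
  open import Algebra.Solver.Ring.NaturalCoefficients.Default commutativeSemiring
  open import Relation.Binary.Reasoning.Setoid setoid
  open Divisibility R using (pow-+)

  Idempotent : Carrier → Set ℓ
  Idempotent = _*_ IdempotentOn_

  Idempotent-resp : ∀ {x y} → x ≈ y → Idempotent y → Idempotent x
  Idempotent-resp x≈y yy≈y = trans (*-cong x≈y x≈y) (trans yy≈y (sym x≈y))

  Idempotent-0 : Idempotent 0#
  Idempotent-0 = zeroˡ 0#

  Idempotent-1 : Idempotent 1#
  Idempotent-1 = *-identityˡ 1#

  Idempotent-* : ∀ {x y} → Idempotent x → Idempotent y → Idempotent (x * y)
  Idempotent-* {x} {y} xx≈x yy≈y = begin
    (x * y) * (x * y) ≈⟨ solve 2 (λ x y → (x :* y) :* (x :* y) := (x :* x) :* (y :* y)) refl x y ⟩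
    (x * x) * (y * y) ≈⟨ *-cong xx≈x yy≈y ⟩
    x * y             ∎

  Idempotent-unit≈1 : ∀ {e} → Idempotent e → IsUnit e → e ≈ 1#
  Idempotent-unit≈1 {e} ee≈e (v , ev≈1) = begin
    e             ≈⟨ *-identityʳ e ⟨
    e * 1#        ≈⟨ *-congˡ ev≈1 ⟨
    e * (e * v)   ≈⟨ *-assoc e e v ⟨
    (e * e) * v   ≈⟨ *-congʳ ee≈e ⟩
    e * v         ≈⟨ ev≈1 ⟩
    1#            ∎

  -- With e = xz idempotent and x(1 − e) = 0, x + (1 − e) is a unit with inverse ze + (1 − e).
  unit-idempotent-decomposition : ∀ x z → Idempotent (x * z) → x * (1# - x * z) ≈ 0# →
                                  ∃ λ y → IsUnit y × x ≈ y * (x * z)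
  unit-idempotent-decomposition x z ee≈e xf≈0 = x + f , (z * e + f , yy′≈1) , x≈ye
    where
    e = x * z
    f = 1# - e
    e+f≈1 : e + f ≈ 1#
    e+f≈1 = trans (solve 2 (λ e n → e :+ (con 1 :+ n) := con 1 :+ (e :+ n)) refl e (- e))
                  (trans (+-congˡ (-‿inverseʳ e)) (+-identityʳ 1#))
    ef≈0 : e * f ≈ 0#
    ef≈0 = trans (x[y-z]≈xy-xz e 1# e) (trans (+-cong (*-identityʳ e) (-‿cong ee≈e)) (-‿inverseʳ e))
    ff≈f : f * f ≈ f
    ff≈f = begin
      f * f               ≈⟨ x[y-z]≈xy-xz f 1# e ⟩
      f * 1# - f * e      ≈⟨ +-cong (*-identityʳ f) (-‿cong (trans (*-comm f e) ef≈0)) ⟩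
      f - 0#              ≈⟨ +-congˡ -0#≈0# ⟩
      f + 0#              ≈⟨ +-identityʳ f ⟩
      f                   ∎
    yy′≈1 : (x + f) * (z * e + f) ≈ 1#
    yy′≈1 = begin
      (x + f) * (z * e + f)
        ≈⟨ solve 4 (λ x f z e → (x :+ f) :* (z :* e :+ f) := (x :* z) :* e :+ x :* f :+ (z :* (e :* f) :+ f :* f))
                 refl x f z e ⟩
      e * e + x * f + (z * (e * f) + f * f)
        ≈⟨ +-cong (+-cong ee≈e xf≈0) (+-cong (trans (*-congˡ ef≈0) (zeroʳ z)) ff≈f) ⟩
      e + 0# + (0# + f)   ≈⟨ +-cong (+-identityʳ e) (+-identityˡ f) ⟩
      e + f               ≈⟨ e+f≈1 ⟩
      1#                  ∎
    x≈ye : x ≈ (x + f) * e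
    x≈ye = begin
      x                   ≈⟨ *-identityʳ x ⟨
      x * 1#              ≈⟨ *-congˡ e+f≈1 ⟨
      x * (e + f)         ≈⟨ distribˡ x e f ⟩
      x * e + x * f       ≈⟨ +-cong refl (trans xf≈0 (sym (trans (*-comm f e) ef≈0))) ⟩
      x * e + f * e       ≈⟨ distribʳ e x f ⟨
      (x + f) * e         ∎

  module Finite {n} (f : Fin n → Carrier) (onto : ∀ x → ∃ λ i → f i ≈ x) where

    pow-periodic : ∀ x s q → pow x s ≈ pow x (s ℕ.+ q) →
                   ∀ m l → pow x (s ℕ.+ m) ≈ pow x (s ℕ.+ m ℕ.+ q ℕ.* l)
    pow-periodic x s q _ m zero =
      reflexive (≡.cong (pow x) (≡.sym (≡.trans (≡.cong (s ℕ.+ m ℕ.+_) (ℕ.*-zeroʳ q)) (ℕ.+-identityʳ _))))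
    pow-periodic x s q xˢ≈xˢ⁺ᑫ m (suc l) = begin
      pow x (s ℕ.+ m)                           ≈⟨ pow-periodic x s q xˢ≈xˢ⁺ᑫ m l ⟩
      pow x (s ℕ.+ m ℕ.+ q ℕ.* l)               ≡⟨ ≡.cong (pow x) (ℕ.+-assoc s m (q ℕ.* l)) ⟩
      pow x (s ℕ.+ (m ℕ.+ q ℕ.* l))             ≈⟨ pow-+ x s (m ℕ.+ q ℕ.* l) ⟩
      pow x s * pow x (m ℕ.+ q ℕ.* l)           ≈⟨ *-congʳ xˢ≈xˢ⁺ᑫ ⟩
      pow x (s ℕ.+ q) * pow x (m ℕ.+ q ℕ.* l)   ≈⟨ pow-+ x (s ℕ.+ q) (m ℕ.+ q ℕ.* l) ⟨
      pow x (s ℕ.+ q ℕ.+ (m ℕ.+ q ℕ.* l))       ≡⟨ ≡.cong (pow x) (reorder s q m l) ⟩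
      pow x (s ℕ.+ m ℕ.+ q ℕ.* suc l)           ∎
      where
      reorder : ∀ s q m l → s ℕ.+ q ℕ.+ (m ℕ.+ q ℕ.* l) ≡.≡ s ℕ.+ m ℕ.+ q ℕ.* suc l
      reorder = solve-∀

    -- Among x¹, …, xⁿ⁺¹ two coincide, say xˢ ≈ xˢ⁺ᑫ; then xᑫˢ is idempotent.
    idempotent-power : ∀ x → ∃ λ k → Idempotent (pow x (suc k))
    idempotent-power x with Fin.pigeonhole (ℕ.n<1+n n) (λ i → proj₁ (onto (pow x (suc (toℕ i)))))
    ... | i , j , i<j , same-index = toℕ i ℕ.+ r ℕ.* s , (begin
      pow x (s ℕ.+ r ℕ.* s) * pow x (s ℕ.+ r ℕ.* s)   ≈⟨ pow-+ x (s ℕ.+ r ℕ.* s) (s ℕ.+ r ℕ.* s) ⟨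
      pow x (s ℕ.+ r ℕ.* s ℕ.+ q ℕ.* s)               ≈⟨ pow-periodic x s q xˢ≈xˢ⁺ᑫ (r ℕ.* s) s ⟨
      pow x (s ℕ.+ r ℕ.* s)                           ∎)
      where
      s = suc (toℕ i)
      r = proj₁ (ℕ.m≤n⇒∃[o]m+o≡n i<j)
      q = suc r
      s+q≡1+j : s ℕ.+ q ≡.≡ suc (toℕ j)
      s+q≡1+j = ≡.trans (ℕ.+-suc s r) (≡.cong suc (proj₂ (ℕ.m≤n⇒∃[o]m+o≡n i<j)))
      xˢ≈xˢ⁺ᑫ : pow x s ≈ pow x (s ℕ.+ q)
      xˢ≈xˢ⁺ᑫ = begin
        pow x s                                  ≈⟨ proj₂ (onto (pow x s)) ⟨
        f (proj₁ (onto (pow x s)))               ≡⟨ ≡.cong f same-index ⟩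
        f (proj₁ (onto (pow x (suc (toℕ j)))))   ≈⟨ proj₂ (onto _) ⟩
        pow x (suc (toℕ j))                      ≡⟨ ≡.cong (pow x) s+q≡1+j ⟨
        pow x (s ℕ.+ q)                          ∎

module Quotient {c ℓ} (R : CommutativeRing c ℓ) (a : CommutativeRing.Carrier R) where
  open CommutativeRing R hiding (zero)
  open RingDefs R renaming (_∣_ to infix 4 _∣_)
  open RingDefs.Quot R a using () renaming (_~_ to infix 4 _~_)
  open Divisibility R
  open import Algebra.Properties.Ring ring
    using (x[y-z]≈xy-xz; [y-z]x≈yx-zx; x≈y⇒x∙y⁻¹≈ε; ⁻¹-anti-homo‿-; -0#≈0#)
  open import Algebra.Properties.AbelianGroup +-abelianGroup using (⁻¹-∙-comm)
  open import Algebra.Solver.Ring.NaturalCoefficients.Default commutativeSemiring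
  open import Relation.Binary.Reasoning.Setoid setoid

  ≈⇒~ : ∀ {x y} → x ≈ y → x ~ y
  ≈⇒~ x≈y = ∣-respʳ (sym (x≈y⇒x∙y⁻¹≈ε x≈y)) (x∣0 a)

  ~-refl : ∀ {x} → x ~ x
  ~-refl = ≈⇒~ refl

  ~-sym : ∀ {x y} → x ~ y → y ~ x
  ~-sym {x} {y} x~y = ∣-respʳ (⁻¹-anti-homo‿- x y) (∣-neg x~y)

  ~-trans : ∀ {x y z} → x ~ y → y ~ z → x ~ z
  ~-trans {x} {y} {z} x~y y~z = ∣-respʳ telescope (∣-+ x~y y~z)
    where
    telescope : (x - y) + (y - z) ≈ x - z
    telescope = begin
      (x - y) + (y - z)   ≈⟨ solve 4 (λ x -y y -z → (x :+ -y) :+ (y :+ -z) := (x :+ -z) :+ (y :+ -y))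
                                   refl x (- y) y (- z) ⟩
      (x - z) + (y - y)   ≈⟨ +-congˡ (-‿inverseʳ y) ⟩
      (x - z) + 0#        ≈⟨ +-identityʳ _ ⟩
      x - z               ∎

  ~-+ : ∀ {x x′ y y′} → x ~ x′ → y ~ y′ → x + y ~ x′ + y′
  ~-+ {x} {x′} {y} {y′} x~x′ y~y′ = ∣-respʳ regroup (∣-+ x~x′ y~y′)
    where
    regroup : (x - x′) + (y - y′) ≈ (x + y) - (x′ + y′)
    regroup = begin
      (x - x′) + (y - y′)       ≈⟨ solve 4 (λ x -x′ y -y′ → (x :+ -x′) :+ (y :+ -y′) := (x :+ y) :+ (-x′ :+ -y′))
                                         refl x (- x′) y (- y′) ⟩
      (x + y) + (- x′ + - y′)   ≈⟨ +-congˡ (⁻¹-∙-comm x′ y′) ⟩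
      (x + y) - (x′ + y′)       ∎

  ~-* : ∀ {x x′ y y′} → x ~ x′ → y ~ y′ → x * y ~ x′ * y′
  ~-* {x} {x′} {y} {y′} x~x′ y~y′ = ~-trans (∣-respʳ (x[y-z]≈xy-xz x y y′) (x∣y⇒x∣zy x y~y′))
                                            (∣-respʳ ([y-z]x≈yx-zx y′ x x′) (x∣y⇒x∣yz y′ x~x′))

  ~-neg : ∀ {x x′} → x ~ x′ → - x ~ - x′
  ~-neg {x} {x′} x~x′ = ∣-respʳ (sym (⁻¹-∙-comm x (- x′))) (∣-neg x~x′)

  quotientRing : CommutativeRing c (c ⊔ ℓ)
  quotientRing = record
    { Carrier = Carrier ; _≈_ = _~_ ; _+_ = _+_ ; _*_ = _*_ ; -_ = -_ ; 0# = 0# ; 1# = 1#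
    ; isCommutativeRing = record
      { isRing = record
        { +-isAbelianGroup = record
          { isGroup = record
            { isMonoid = record
              { isSemigroup = record
                { isMagma = record
                  { isEquivalence = record { refl = ~-refl ; sym = ~-sym ; trans = ~-trans }
                  ; ∙-cong = ~-+
                  }
                ; assoc = λ x y z → ≈⇒~ (+-assoc x y z)
                }
              ; identity = (λ x → ≈⇒~ (+-identityˡ x)) , (λ x → ≈⇒~ (+-identityʳ x))
              }
            ; inverse = (λ x → ≈⇒~ (-‿inverseˡ x)) , (λ x → ≈⇒~ (-‿inverseʳ x))
            ; ⁻¹-cong = ~-neg
            }
          ; comm = λ x y → ≈⇒~ (+-comm x y)
          }
        ; *-cong = ~-*
        ; *-assoc = λ x y z → ≈⇒~ (*-assoc x y z)
        ; *-identity = (λ x → ≈⇒~ (*-identityˡ x)) , (λ x → ≈⇒~ (*-identityʳ x))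
        ; distrib = (λ x y z → ≈⇒~ (distribˡ x y z)) , (λ x y z → ≈⇒~ (distribʳ x y z))
        }
      ; *-comm = λ x y → ≈⇒~ (*-comm x y)
      }
    }

  ∣⇒~0 : ∀ {x} → a ∣ x → x ~ 0#
  ∣⇒~0 {x} = ∣-respʳ (sym (trans (+-congˡ -0#≈0#) (+-identityʳ x)))

  ∣-resp-~ : ∀ {d x y} → d ∣ a → x ~ y → d ∣ x → d ∣ y
  ∣-resp-~ d∣a x~y d∣x = ∣-−⁻ d∣x (∣-trans d∣a x~y)

  module Finite (finite : RingDefs.Quot.IsFinite R a) where
    open CommutativeRing quotientRing using () renaming (setoid to quotientSetoid)

    size : ℕ
    size = proj₁ finite

    element : Fin size → Carrier
    element = proj₁ (proj₂ finite)

    element-onto : ∀ x → ∃ λ i → element i ~ x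
    element-onto = proj₁ (proj₂ (proj₂ finite))

    _~?_ : Decidable _~_
    _~?_ = enumerated⇒decidable quotientSetoid element element-onto (proj₂ (proj₂ (proj₂ finite)))

    -- d ∣ y iff y ~ d·r for some representative r, which can be searched for.
    ∣? : ∀ {d} → d ∣ a → ∀ y → Dec (d ∣ y)
    ∣? {d} d∣a y with Fin.any? (λ j → y ~? (d * element j))
    ... | yes (j , y~dr) = yes (∣-resp-~ d∣a (~-sym y~dr) (x∣y⇒x∣yz (element j) (∣-refl d)))
    ... | no ∄j = no λ { (k , y≈dk) →
      ∄j (proj₁ (element-onto k) , ~-trans (≈⇒~ y≈dk) (~-* ~-refl (~-sym (proj₂ (element-onto k))))) }

module ResidueRing {c ℓ} (R : CommutativeRing c ℓ) (ufd : RingDefs.IsUFD R) (a : CommutativeRing.Carrier R)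
            (a≉0 : ¬ CommutativeRing._≈_ R a (CommutativeRing.0# R)) (finite : RingDefs.Quot.IsFinite R a) where
  open CommutativeRing R hiding (zero)
  open RingDefs R renaming (_∣_ to infix 4 _∣_)
  open RingDefs.Quot R a using (IsIdempotent; IsUnitQ; IsIr; IsDUnits) renaming (_~_ to infix 4 _~_)
  open Divisibility R
  open IntegralDomain R (proj₁ ufd)
  open UniqueFactorisation R ufd
  open Representatives R
  open Quotient R a
  open Quotient.Finite R a finite
  module Q = CommutativeRing quotientRing
  open Idempotents quotientRing using (Idempotent-resp; Idempotent-0; Idempotent-1; Idempotent-*;
                                       Idempotent-unit≈1; unit-idempotent-decomposition)
  open Idempotents.Finite quotientRing element element-onto
    using () renaming (idempotent-power to idempotent-powerQ)
  open SubProduct Q.*-commutativeMonoid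
  open Divisibility quotientRing using () renaming (IsUnit-1 to IsUnitQ-1; IsUnit-* to IsUnitQ-*)
  open import Algebra.Properties.Ring ring using (x[y-z]≈xy-xz)
  open import Algebra.Solver.Ring.NaturalCoefficients.Default commutativeSemiring
  open import Relation.Binary.Reasoning.Setoid setoid

  -- IsIr and IsDUnits are, definitionally, IsLeastPos of these two predicates.
  IdempotentSubproducts : ℕ → Set (c ⊔ ℓ)
  IdempotentSubproducts = SubproductProperty id IsIdempotent

  UnitSubproducts : ℕ → Set (c ⊔ ℓ)
  UnitSubproducts = SubproductProperty {X = Σ Carrier IsUnitQ} proj₁ (_~ 1#)

  ∏-IsUnitQ : ∀ {n} (g : Fin n → Σ Carrier IsUnitQ) S → IsUnitQ (∏ (proj₁ ∘ g) S)
  ∏-IsUnitQ g = ∏-closed IsUnitQ IsUnitQ-1 IsUnitQ-* (proj₁ ∘ g) (proj₂ ∘ g)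

  pow-quotient : ∀ x k → RingDefs.pow quotientRing x k ≡.≡ pow x k
  pow-quotient x zero = ≡.refl
  pow-quotient x (suc k) = ≡.cong (x *_) (pow-quotient x k)

  idempotent-power : ∀ x → ∃ λ j → IsIdempotent (pow x (suc j))
  idempotent-power x = j , ≡.subst IsIdempotent (pow-quotient x (suc j)) (proj₂ (idempotent-powerQ x))
    where j = proj₁ (idempotent-powerQ x)

  -- Irreducible-∣-* needs x, y ≉ 0; deciding p ∣ x and p ∣ y first (R/(a) is finite) covers those cases.
  Irreducible-∣a⇒Prime : ∀ {p} → Irreducible p → p ∣ a → Prime p
  Irreducible-∣a⇒Prime {p} p-irr p∣a = p-irr , euclid
    where
    euclid : ∀ x y → p ∣ x * y → p ∣ x ⊎ p ∣ y
    euclid x y p∣xy with ∣? p∣a x | ∣? p∣a y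
    ... | yes p∣x | _ = inj₁ p∣x
    ... | no _ | yes p∣y = inj₂ p∣y
    ... | no p∤x | no p∤y = Irreducible-∣-* p-irr (λ x≈0 → p∤x (∣-respʳ (sym x≈0) (x∣0 p)))
                                                 (λ y≈0 → p∤y (∣-respʳ (sym y≈0) (x∣0 p))) p∣xy

  IsIdempotent⇒∣ : ∀ {e} → IsIdempotent e → a ∣ e * (1# - e)
  IsIdempotent⇒∣ {e} ee~e =
    ∣-respʳ (trans (+-congʳ (sym (*-identityʳ e))) (sym (x[y-z]≈xy-xz e 1# e))) (~-sym ee~e)

  ∤-idempotent⇒∣-complement : ∀ {p e} → Prime p → p ∣ a → IsIdempotent e → ¬ p ∣ e → p ∣ 1# - e
  ∤-idempotent⇒∣-complement (_ , euclid) p∣a idem p∤e =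
    [ (λ p∣e → contradiction p∣e p∤e) , id ]′ (euclid _ _ (∣-trans p∣a (IsIdempotent⇒∣ idem)))

  Prime-∣-x[1-xʲ⁺¹] : ∀ {r x j} → Prime r → r ∣ a → IsIdempotent (pow x (suc j)) →
                      r ∣ x * (1# - pow x (suc j))
  Prime-∣-x[1-xʲ⁺¹] {r} {x} {j} r-prime r∣a e-idem = by-cases (∣? r∣a x)
    where
    by-cases : Dec (r ∣ x) → r ∣ x * (1# - pow x (suc j))
    by-cases (yes r∣x) = x∣y⇒x∣yz _ r∣x
    by-cases (no r∤x) =
      x∣y⇒x∣zy x (∤-idempotent⇒∣-complement r-prime r∣a e-idem (r∤x ∘ Prime-∣-pow r-prime (suc j)))

  extra-factor-obstructs : ∀ {b P U l} → b * P ∣ a → Prime l → l ∣ b → l ∣ P → IsUnitQ U →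
                           ¬ IsIdempotent (U * P)
  extra-factor-obstructs {b} {P} {U} {l} bP∣a (l-irr , euclid) l∣b l∣P (V , UV~1) idem =
    [ l∤U , l∤x-1 ]′ (euclid U (x - 1#) l∣U[x-1])
    where
    x = U * P
    l∣a : l ∣ a
    l∣a = ∣-trans l∣b (∣-trans (x∣y⇒x∣yz P (∣-refl b)) bP∣a)
    P≉0 : ¬ P ≈ 0#
    P≉0 P≈0 = a≉0 (trans (proj₂ bP∣a) (trans (*-congʳ (trans (*-congˡ P≈0) (zeroʳ b))) (zeroˡ _)))
    xx-x≈P[U[x-1]] : x * x - x ≈ P * (U * (x - 1#))
    xx-x≈P[U[x-1]] = begin
      x * x - x             ≈⟨ +-congˡ (-‿cong (*-identityʳ x)) ⟨
      x * x - x * 1#        ≈⟨ x[y-z]≈xy-xz x x 1# ⟨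
      x * (x - 1#)          ≈⟨ solve 3 (λ U P y → (U :* P) :* y := P :* (U :* y)) refl U P (x - 1#) ⟩
      P * (U * (x - 1#))    ∎
    l∣U[x-1] : l ∣ U * (x - 1#)
    l∣U[x-1] = ∣-trans l∣b
      (*-cancelˡ-∣ P≉0 (∣-respˡ (*-comm b P) (∣-trans bP∣a (∣-respʳ xx-x≈P[U[x-1]] idem))))
    l∤U : ¬ l ∣ U
    l∤U l∣U = Irreducible⇒∤1 l-irr (∣-resp-~ l∣a UV~1 (x∣y⇒x∣yz V l∣U))
    l∤x-1 : ¬ l ∣ x - 1#
    l∤x-1 = Irreducible⇒∤1 l-irr ∘ ∣-−⁻ (x∣y⇒x∣zy U l∣P)

  module Factors {u ps qs} (a-factorization : Factorization a u ps) (distinct : DistinctPrimes ps qs) where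
    private
      representatives = pick-representatives qs (proj₁ distinct) (proj₁ (proj₂ distinct))

    Rs Ls : List Carrier
    Rs = proj₁ representatives
    Ls = proj₁ (proj₂ representatives)

    ps↭Rs++Ls : ps ↭ Rs List.++ Ls
    ps↭Rs++Ls = proj₁ (proj₂ (proj₂ representatives))

    qs≋Rs : Pointwise Assoc qs Rs
    qs≋Rs = proj₂ (proj₂ (proj₂ representatives))

    length-Ls : length Ls ≡.≡ length ps ∸ length qs
    length-Ls = ≡.sym (≡.trans
      (≡.cong₂ _∸_ (≡.trans (↭.↭-length ps↭Rs++Ls) (List.length-++ Rs)) (Pointwise-length qs≋Rs))
      (ℕ.m+n∸m≡n (length Rs) (length Ls)))

    a≈u[∏Rs∏Ls] : a ≈ u * (prod Rs * prod Ls)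
    a≈u[∏Rs∏Ls] = trans (proj₂ (proj₂ a-factorization)) (*-congˡ (trans
      (foldr-commMonoid *-isCommutativeMonoid (↭⇒↭ₛ′ isEquivalence ps↭Rs++Ls)) (prod-++ Rs Ls)))
      where open PermutationProperties setoid using (foldr-commMonoid)

    ∏Rs∏Ls∣a : prod Rs * prod Ls ∣ a
    ∏Rs∏Ls∣a = u , trans a≈u[∏Rs∏Ls] (*-comm u _)

    private
      Rs++Ls-irreducible : All Irreducible (Rs List.++ Ls)
      Rs++Ls-irreducible = ↭.All-resp-↭ ps↭Rs++Ls (proj₁ (proj₂ a-factorization))

    Ls-irreducible : All Irreducible Ls
    Ls-irreducible = All.++⁻ʳ Rs Rs++Ls-irreducible

    ∏Rs∣a : prod Rs ∣ a
    ∏Rs∣a = ∣-trans (x∣y⇒x∣yz (prod Ls) (∣-refl _)) ∏Rs∏Ls∣a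

    Rs∣a : All (_∣ a) Rs
    Rs∣a = All.tabulate λ r∈Rs → ∣-trans (∣-prod (Any.map (≈⇒∣ ∘ reflexive) r∈Rs)) ∏Rs∣a

    Rs-prime : All Prime Rs
    Rs-prime = All.zipWith (λ (r-irr , r∣a) → Irreducible-∣a⇒Prime r-irr r∣a)
                           (All.++⁻ˡ Rs Rs++Ls-irreducible , Rs∣a)

    Rs-distinct : AllPairs (λ p q → ¬ Assoc p q) Rs
    Rs-distinct = AllPairs-resp-Pointwise ≉-resp₂ qs≋Rs (proj₁ distinct)
      where open import Relation.Binary.Properties.Setoid Assoc-setoid using (≉-resp₂)

    Ls-repeat : All (λ l → Any (Assoc l) Rs) Ls
    Ls-repeat = All.map (Any-resp-Pointwise (λ q~r l~q → Assoc-trans l~q q~r) qs≋Rs)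
                        (All.++⁻ʳ Rs (↭.All-resp-↭ ps↭Rs++Ls (proj₂ (proj₂ distinct))))

    no-extra-factors : ∀ {d} (g : Fin d → Σ Carrier IsUnitQ) S₁ S₂ →
                       IsIdempotent (∏ (proj₁ ∘ g) S₁ * ∏ (lookup Ls) S₂) → Empty S₂
    no-extra-factors g S₁ S₂ idem (i , i∈S₂) =
      extra-factor-obstructs ∏Rs·P∣a (Irreducible-∣a⇒Prime l-irr (∣-trans l∣∏Rs ∏Rs∣a)) l∣∏Rs l∣P
                             (∏-IsUnitQ g S₁) idem
      where
      ∏Rs·P∣a : prod Rs * ∏ (lookup Ls) S₂ ∣ a
      ∏Rs·P∣a = ∣-trans (*-∣-* (∣-refl (prod Rs)) (∏-∣-prod Ls S₂)) ∏Rs∏Ls∣a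
      l-irr : Irreducible (lookup Ls i)
      l-irr = All.lookup Ls-irreducible (∈-lookup i)
      l∣∏Rs : lookup Ls i ∣ prod Rs
      l∣∏Rs = ∣-prod (Any.map Assoc⇒∣ (All.lookup Ls-repeat (∈-lookup i)))
      l∣P : lookup Ls i ∣ ∏ (lookup Ls) S₂
      l∣P = ∈⇒∣∏ (lookup Ls) i∈S₂

    IdempotentSubproducts⇒UnitSubproducts : ∀ d → IdempotentSubproducts (d ℕ.+ length Ls) → UnitSubproducts d
    IdempotentSubproducts⇒UnitSubproducts d idempotent g = restrict (idempotent ((proj₁ ∘ g) Seq.++ lookup Ls))
      where
      restrict : (∃ λ S → Nonempty S × IsIdempotent (∏ ((proj₁ ∘ g) Seq.++ lookup Ls) S)) →
                 ∃ λ S → Nonempty S × ∏ (proj₁ ∘ g) S ~ 1#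
      restrict (S , S-nonempty , S-idem) = S₁ , S₁-nonempty , Idempotent-unit≈1 U-idem (∏-IsUnitQ g S₁)
        where
        S₁ = Vec.take d S
        S₂ = Vec.drop d S
        UP-idem : IsIdempotent (∏ (proj₁ ∘ g) S₁ * ∏ (lookup Ls) S₂)
        UP-idem = Idempotent-resp (Q.sym (∏-split (proj₁ ∘ g) (lookup Ls) S)) S-idem
        S₂-empty : Empty S₂
        S₂-empty = no-extra-factors g S₁ S₂ UP-idem
        U-idem : IsIdempotent (∏ (proj₁ ∘ g) S₁)
        U-idem = Idempotent-resp (Q.sym (Q.trans (Q.*-congˡ (∏-Empty (lookup Ls) S₂-empty)) (Q.*-identityʳ _))) UP-idem
        S₁-nonempty : Nonempty S₁
        S₁-nonempty = [ id , (λ S₂-nonempty → contradiction S₂-nonempty S₂-empty) ]′ (Nonempty-split d S S-nonempty)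

    lower-bound : ∀ {t d} → IsIr t → IsDUnits d → d ℕ.+ length Ls ℕ.≤ t
    lower-bound {t} {d} It Id = ℕ.m≤o∸n⇒m+n≤o d Ls≤t d≤t∸Ls
      where
      t≤t∸Ls+Ls : t ℕ.≤ t ∸ length Ls ℕ.+ length Ls
      t≤t∸Ls+Ls = ℕ.≤-trans (ℕ.m≤n+m∸n t (length Ls)) (ℕ.≤-reflexive (ℕ.+-comm (length Ls) _))
      d≤t∸Ls : d ℕ.≤ t ∸ length Ls
      d≤t∸Ls = IsLeastPos-≤ Id (¬SubproductProperty-0 proj₁ (_~ 1#))
                 (IdempotentSubproducts⇒UnitSubproducts (t ∸ length Ls)
                   (SubproductProperty-mono id IsIdempotent (Idempotent-resp ∘ Q.sym) t≤t∸Ls+Ls (proj₁ (proj₂ It))))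
      Ls≤t : length Ls ℕ.≤ t
      Ls≤t = ℕ.<⇒≤ (ℕ.m∸n≢0⇒n<m (λ t∸Ls≡0 → ℕ.<⇒≢ (ℕ.≤-trans (proj₁ Id) d≤t∸Ls) (≡.sym t∸Ls≡0)))

    IsIr-determined : ∀ {t d m} → IsIr t → IsDUnits d → IdempotentSubproducts m → m ℕ.≤ d ℕ.+ length Ls →
                      t ≡.≡ d ℕ.+ (length ps ∸ length qs)
    IsIr-determined {d = d} It Id idempotent m≤d+Ls =
      ≡.trans (ℕ.≤-antisym (ℕ.≤-trans (IsLeastPos-≤ It (¬SubproductProperty-0 id IsIdempotent) idempotent) m≤d+Ls)
                           (lower-bound It Id))
              (≡.cong (d ℕ.+_) length-Ls)

    module PrimePower (prime-power : IsPrimePower a) where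
      p : Carrier
      p = proj₁ prime-power
      k : ℕ
      k = proj₁ (proj₂ prime-power)
      p-irr : Irreducible p
      p-irr = proj₁ (proj₂ (proj₂ prime-power))
      a~pᵏ : Assoc a (pow p k)
      a~pᵏ = proj₂ (proj₂ (proj₂ (proj₂ prime-power)))

      p∣a : p ∣ a
      p∣a = ∣-trans (∣-respˡ (*-identityʳ p) (pow-mono-∣ p (proj₁ (proj₂ (proj₂ (proj₂ prime-power))))))
                    (Assoc⇒∣ (Assoc-sym a~pᵏ))

      p-prime : Prime p
      p-prime = Irreducible-∣a⇒Prime p-irr p∣a

      ps~p : All (λ q → Assoc q p) ps
      ps~p = All.tabulate λ q∈ps → q~p (All.lookup (proj₁ (proj₂ a-factorization)) q∈ps)
                                     (Factorization⇒∣ a-factorization (Any.map (λ { ≡.refl → Assoc-refl _ }) q∈ps))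
        where
        q~p : ∀ {q} → Irreducible q → q ∣ a → Assoc q p
        q~p q-irr q∣a = Assoc-sym (Irreducible-∣⇒Assoc q-irr p-irr
          (Prime-∣-pow (Irreducible-∣a⇒Prime q-irr q∣a) k (∣-trans q∣a (Assoc⇒∣ a~pᵏ))))

      length-Rs : length Rs ≡.≡ 1
      length-Rs = ≡.trans (≡.sym (Pointwise-length qs≋Rs))
        (one-class (proj₁ distinct) (All.map (λ q~ps → Any-Assoc-trans q~ps ps~p) (proj₁ (proj₂ distinct))) some-class)
        where
        some-class : ∃ λ x → Any (Assoc x) qs
        some-class = _ , proj₁ (All.lookupAny (proj₂ (proj₂ distinct))
          (Prime-∣-unit*prod p-prime (proj₁ a-factorization) ps (∣-respʳ (proj₂ (proj₂ a-factorization)) p∣a)))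
        one-class : ∀ {xs} → AllPairs (λ x y → ¬ Assoc x y) xs → All (λ x → Assoc x p) xs →
                    (∃ λ y → Any (Assoc y) xs) → length xs ≡.≡ 1
        one-class [] [] (_ , ())
        one-class ([] ∷ []) _ _ = ≡.refl
        one-class ((x≁y ∷ _) ∷ _) (x~p ∷ y~p ∷ _) _ = contradiction (Assoc-trans x~p (Assoc-sym y~p)) x≁y

      a~pᴷ : Assoc a (pow p (suc (length Ls)))
      a~pᴷ = ≡.subst (λ n → Assoc a (pow p n)) length-ps
               (Assoc-trans (u , proj₁ a-factorization , proj₂ (proj₂ a-factorization)) (prod-Assoc-pow ps ps~p))
        where
        length-ps : length ps ≡.≡ suc (length Ls)
        length-ps = ≡.trans (↭.↭-length ps↭Rs++Ls) (≡.trans (List.length-++ Rs) (≡.cong (ℕ._+ length Ls) length-Rs))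

      -- For x prime to p, the idempotent power e = xʲ⁺¹ has pᴷ ∣ e(1 − e), hence pᴷ ∣ 1 − e.
      unit-unless-divisible : ∀ {x} → ¬ p ∣ x → IsUnitQ x
      unit-unless-divisible {x} p∤x = pow x j , ~-sym (∣-trans (Assoc⇒∣ a~pᴷ) pᴷ∣1-e)
        where
        j = proj₁ (idempotent-power x)
        pᴷ∣1-e : pow p (suc (length Ls)) ∣ 1# - pow x (suc j)
        pᴷ∣1-e = Prime-pow-∣-cancel p-prime (p∤x ∘ Prime-∣-pow p-prime (suc j)) (suc (length Ls)) _
                   (∣-trans (Assoc⇒∣ (Assoc-sym a~pᴷ)) (IsIdempotent⇒∣ (proj₂ (idempotent-power x))))

      unit-or-one : ∀ x → Dec (p ∣ x) → Σ Carrier IsUnitQ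
      unit-or-one x (yes _) = 1# , IsUnitQ-1
      unit-or-one x (no p∤x) = x , unit-unless-divisible p∤x

      unit-or-one-≡ : ∀ x (p∣x? : Dec (p ∣ x)) → ¬ p ∣ x → proj₁ (unit-or-one x p∣x?) ≡.≡ x
      unit-or-one-≡ x (yes p∣x) p∤x = contradiction p∣x p∤x
      unit-or-one-≡ x (no _) _ = ≡.refl

      units-of : ∀ {n} → (Fin n → Carrier) → Fin n → Σ Carrier IsUnitQ
      units-of s i = unit-or-one (s i) (∣? p∣a (s i))

      divisible-positions : ∀ {n} → (Fin n → Carrier) → Subset n
      divisible-positions s = select (λ i → ∣? p∣a (s i))

      unit-subproduct : ∀ {n} (s : Fin n → Carrier) (T : Subset Subset.∣ ∁ (divisible-positions s) ∣) →
                        ∏ (proj₁ ∘ compress (∁ (divisible-positions s)) (units-of s)) T ~ 1# →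
                        ∏ s (expand (∁ (divisible-positions s)) T) ~ 1#
      unit-subproduct s T T~1 = ~-trans
        (∏-cong (expand C T) λ i i∈ → ≈⇒~ (reflexive (≡.sym (unit-or-one-≡ (s i) (∣? p∣a (s i))
                                          (∈-∁-select⁻ (λ i → ∣? p∣a (s i)) (expand-⊆ C T i∈))))))
        (~-trans (~-sym (∏-compress proj₁ C (units-of s) T)) T~1)
        where
        C = ∁ (divisible-positions s)

      UnitSubproducts⇒IdempotentSubproducts : ∀ d → UnitSubproducts d → IdempotentSubproducts (d ℕ.+ length Ls)
      UnitSubproducts⇒IdempotentSubproducts d D s = by-count (suc (length Ls) ℕ.≤? Subset.∣ N ∣)
        where
        N = divisible-positions s
        Idempotent-subproduct = ∃ λ S → Nonempty S × IsIdempotent (∏ s S)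
        from-units : (∃ λ T → Nonempty T × ∏ (proj₁ ∘ compress (∁ N) (units-of s)) T ~ 1#) → Idempotent-subproduct
        from-units (T , T-nonempty , T~1) =
          expand (∁ N) T , expand-Nonempty (∁ N) T-nonempty , Idempotent-resp (unit-subproduct s T T~1) Idempotent-1
        by-count : Dec (suc (length Ls) ℕ.≤ Subset.∣ N ∣) → Idempotent-subproduct
        by-count (yes K≤∣N∣) = N , 1≤∣S∣⇒Nonempty N (ℕ.≤-trans (s≤s z≤n) K≤∣N∣) ,
                               Idempotent-resp (∣⇒~0 a∣∏) Idempotent-0
          where
          a∣∏ : a ∣ ∏ s N
          a∣∏ = ∣-trans (Assoc⇒∣ a~pᴷ) (∣-trans (pow-mono-∣ p K≤∣N∣)
                                                  (pow-∣-∏ p s N (λ i → ∈-select⁻ (λ j → ∣? p∣a (s j)))))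
        by-count (no K≰∣N∣) = from-units
          (SubproductProperty-mono proj₁ (_~ 1#) (λ y~z y~1 → ~-trans (~-sym y~z) y~1)
            (∁-size-≥ d N (ℕ.≤-pred (ℕ.≰⇒> K≰∣N∣))) D (compress (∁ N) (units-of s)))

    module SquareFree (squarefree : SquareFree a) where
      Ls≡[] : Ls ≡.≡ []
      Ls≡[] = no-repeats Ls Ls-irreducible Ls-repeat ∏Rs∏Ls∣a
        where
        no-repeats : ∀ xs → All Irreducible xs → All (λ l → Any (Assoc l) Rs) xs →
                     prod Rs * prod xs ∣ a → xs ≡.≡ []
        no-repeats [] _ _ _ = ≡.refl
        no-repeats (l ∷ xs) (l-irr ∷ _) (l~Rs ∷ _) ∏Rs∏lxs∣a = contradiction
          (∣-trans (*-∣-* (∣-prod (Any.map Assoc⇒∣ l~Rs)) (x∣y⇒x∣yz (prod xs) (∣-refl l))) ∏Rs∏lxs∣a)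
          (squarefree l l-irr)

      a∣∏Rs : a ∣ prod Rs
      a∣∏Rs = Assoc⇒∣ (u , proj₁ a-factorization ,
                 trans a≈u[∏Rs∏Ls] (*-congˡ (trans (*-congˡ (reflexive (≡.cong prod Ls≡[]))) (*-identityʳ _))))

      -- With e = xʲ⁺¹, every prime r of a divides x or 1 − e, so a ~ ∏Rs divides x(1 − e).
      unit-times-idempotent : ∀ x → ∃₂ λ y e → IsUnitQ y × IsIdempotent e × x ~ y * e
      unit-times-idempotent x =
        proj₁ decomposition , pow x (suc j) , proj₁ (proj₂ decomposition) , e-idem , proj₂ (proj₂ decomposition)
        where
        j = proj₁ (idempotent-power x)
        e-idem = proj₂ (idempotent-power x)
        a∣x[1-e] : a ∣ x * (1# - pow x (suc j))
        a∣x[1-e] = ∣-trans a∣∏Rs (prod-Prime-∣ Rs-prime Rs-distinct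
          (All.zipWith (λ (r-prime , r∣a) → Prime-∣-x[1-xʲ⁺¹] {j = j} r-prime r∣a e-idem) (Rs-prime , Rs∣a)))
        decomposition = unit-idempotent-decomposition x (pow x j) e-idem (∣⇒~0 a∣x[1-e])

      UnitSubproducts⇒IdempotentSubproducts : ∀ d → UnitSubproducts d → IdempotentSubproducts d
      UnitSubproducts⇒IdempotentSubproducts d D s = from-units (D (λ i → y i , y-unit i))
        where
        y e : Fin d → Carrier
        y i = proj₁ (unit-times-idempotent (s i))
        e i = proj₁ (proj₂ (unit-times-idempotent (s i)))
        y-unit : ∀ i → IsUnitQ (y i)
        y-unit i = proj₁ (proj₂ (proj₂ (unit-times-idempotent (s i))))
        e-idem : ∀ i → IsIdempotent (e i)
        e-idem i = proj₁ (proj₂ (proj₂ (proj₂ (unit-times-idempotent (s i)))))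
        s~ye : ∀ i → s i ~ y i * e i
        s~ye i = proj₂ (proj₂ (proj₂ (proj₂ (unit-times-idempotent (s i)))))
        from-units : (∃ λ S → Nonempty S × ∏ y S ~ 1#) → ∃ λ S → Nonempty S × IsIdempotent (∏ s S)
        from-units (S , S-nonempty , ∏y~1) =
          S , S-nonempty , Idempotent-resp ∏s~∏e (∏-closed IsIdempotent Idempotent-1 Idempotent-* e e-idem S)
          where
          ∏s~∏e : ∏ s S ~ ∏ e S
          ∏s~∏e = ~-trans (∏-cong S (λ i _ → s~ye i))
                    (~-trans (∏-∙ y e S) (~-trans (Q.*-congʳ ∏y~1) (Q.*-identityˡ _)))

open import Data.Nat using (_+_; _≤_)
open import Relation.Binary.PropositionalEquality using (_≡_)

theorem5p2 : ∀ {c ℓ} (R : CommutativeRing c ℓ) → RingDefs.IsUFD R →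
    (a : CommutativeRing.Carrier R) → ¬ (CommutativeRing._≈_ R a (CommutativeRing.0# R)) →
    RingDefs.Quot.IsFinite R a →
    (t d : ℕ) → RingDefs.Quot.IsIr R a t → RingDefs.Quot.IsDUnits R a d →
    (u : CommutativeRing.Carrier R) (ps qs : List (CommutativeRing.Carrier R)) →
    RingDefs.Factorization R a u ps → RingDefs.DistinctPrimes R ps qs →
    (d + (length ps ∸ length qs) ≤ t)
    × (RingDefs.IsPrimePower R a → t ≡ d + (length ps ∸ length qs))
    × (RingDefs.IsPID R → RingDefs.SquareFree R a → t ≡ d + (length ps ∸ length qs))
theorem5p2 R ufd a a≉0 finite t d It Id u ps qs a-factorization distinct =
  ≡.subst (λ n → d + n ≤ t) length-Ls (lower-bound It Id) ,
  (λ prime-power → IsIr-determined It Id (PrimePower.UnitSubproducts⇒IdempotentSubproducts prime-power d D) ℕ.≤-refl) ,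
  -- The PID hypothesis is unused: a squarefree a is associate to the product of its distinct primes.
  (λ _ squarefree → IsIr-determined It Id (SquareFree.UnitSubproducts⇒IdempotentSubproducts squarefree d D) (ℕ.m≤m+n d _))
  where
  open ResidueRing R ufd a a≉0 finite
  open Factors a-factorization distinct
  D = proj₁ (proj₂ Id)
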